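{- Let $q$ be a prime power and $m>1$ an integer. Let $L_1(x),L_2(x)\in\mathbb{F}_q[x]$ be linearized polynomials, let $h(x)\in\mathbb{F}_q[x]$ and $\gamma\in\mathbb{F}_{q^m}$. Then $$F(x):=L_1(x)+\big(L_2(x)+\gamma\big)h\big(\mathrm{Tr}_{\mathbb{F}_{q^m}/\mathbb{F}_q}(x)\big)$$ is a permutation polynomial of $\mathbb{F}_{q^m}$ if and only if both of the following hold: (1) $L_1(x)+\big(L_2(x)+\mathrm{Tr}_{\mathbb{F}_{q^m}/\mathbb{F}_q}(\gamma)\big)h(x)\in\mathbb{F}_q[x]$ is a permutation polynomial of $\mathbb{F}_q$; (2) for every $y\in\mathbb{F}_q$, an element $x\in\mathbb{F}_{q^m}$ satisfies both $L_1(x)+L_2(x)h(y)=0$ and $\mathrm{Tr}_{\mathbb{F}_{q^m}/\mathbb{F}_q}(x)=0$ if and only if $x=0$.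
   Context: $\mathrm{Tr}_{\mathbb{F}_{q^m}/\mathbb{F}_q}(x)=x+x^q+\cdots+x^{q^{m-1}}$. A linearized polynomial over $\mathbb{F}_q$ is a polynomial of the form $\sum_{i=0}^{m-1}a_i x^{q^i}$ with all $a_i\in\mathbb{F}_q$. A permutation polynomial of a finite field $K$ is a polynomial inducing a bijection of $K$. -}

module Defs where

open import Level using (0ℓ)
open import Data.Nat as ℕ using (ℕ; zero; suc; _≤_)
open import Data.Nat.Primality using (Prime)
open import Data.Fin using (Fin)
open import Data.List using (List; []; _∷_)
open import Data.List.Relation.Unary.All using (All)
open import Data.Product using (Σ; ∃; _×_)
open import Relation.Nullary using (¬_)
open import Relation.Binary.PropositionalEquality using (_≡_)
open import Algebra.Structures using (IsCommutativeRing)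
open import Function.Bundles using (_↔_; _⇔_)
open import Function.Definitions using (Bijective)

IsPrimePower : ℕ → Set
IsPrimePower q = Σ ℕ λ p → Σ ℕ λ k → Prime p × 1 ≤ k × q ≡ p ℕ.^ k

record FiniteField (n : ℕ) : Set₁ where
  infixl 6 _+_
  infixl 7 _*_
  field
    Carrier : Set
    _+_ _*_ : Carrier → Carrier → Carrier
    -_ : Carrier → Carrier
    0# 1# : Carrier
    isCommutativeRing : IsCommutativeRing _≡_ _+_ _*_ -_ 0# 1#
    0≢1 : ¬ (0# ≡ 1#)
    inverse : ∀ x → ¬ (x ≡ 0#) → ∃ λ y → x * y ≡ 1#
    enumeration : Carrier ↔ Fin n

-- Notions over K = F_{q^m}, with F_q = { x ∈ K | x^q = x } its subfield of order q.
module _ {n : ℕ} (K : FiniteField n) (q : ℕ) where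
  open FiniteField K

  pow : Carrier → ℕ → Carrier
  pow x zero = 1#
  pow x (suc e) = x * pow x e

  InFq : Carrier → Set
  InFq x = pow x q ≡ x

  sumFin : (m : ℕ) → (Fin m → Carrier) → Carrier
  sumFin zero f = 0#
  sumFin (suc m) f = f Data.Fin.zero + sumFin m (λ i → f (Data.Fin.suc i))

  Tr : ℕ → Carrier → Carrier
  Tr m x = sumFin m (λ i → pow x (q ℕ.^ Data.Fin.toℕ i))

  evalLin : (m : ℕ) → (Fin m → Carrier) → Carrier → Carrier
  evalLin m a x = sumFin m (λ i → a i * pow x (q ℕ.^ Data.Fin.toℕ i))

  evalPoly : List Carrier → Carrier → Carrier
  evalPoly [] x = 0#
  evalPoly (c ∷ cs) x = c + x * evalPoly cs x

  LinOverFq : (m : ℕ) → (Fin m → Carrier) → Set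
  LinOverFq m a = ∀ i → InFq (a i)

  PolyOverFq : List Carrier → Set
  PolyOverFq cs = All InFq cs

  IsPermOfK : (Carrier → Carrier) → Set
  IsPermOfK f = Bijective _≡_ _≡_ f

  IsPermOfFq : (Carrier → Carrier) → Set
  IsPermOfFq f =
    (∀ x → InFq x → InFq (f x)) ×
    (∀ x y → InFq x → InFq y → f x ≡ f y → x ≡ y) ×
    (∀ y → InFq y → ∃ λ x → InFq x × f x ≡ y)

-- Tr : F_{q^m} → F_q is F_q-linear, onto F_q and commutes with linearized
-- polynomials over F_q, so Tr ∘ F = g ∘ Tr for g(y) = L₁(y) + (L₂(y) + Tr γ)·h(y); and
-- on a fibre Tr x = Tr x′ the difference F(x) - F(x′) is L₁(x-x′) + L₂(x-x′)·h(Tr x).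
-- Hence F is injective iff g is injective on F_q and L₁ + h(y)·L₂ has no nonzero root
-- in ker Tr for y ∈ F_q; finiteness turns injectivity into bijectivity both on K and
-- on F_q.
module Submission where

open import Defs
open import Data.Nat using (ℕ; _<_; _^_)
open import Data.Fin using (Fin)
open import Data.List using (List)
open import Data.Product using (_×_)
open import Relation.Binary.PropositionalEquality using (_≡_)
open import Function.Bundles using (_⇔_)

open import Level using (0ℓ)
open import Algebra.Bundles using (CommutativeRing; CommutativeMonoid)
open import Algebra.Structures using (IsCommutativeRing)
open import Algebra.Solver.Ring.AlmostCommutativeRing
  using (fromCommutativeRing; _-Raw-AlmostCommutative⟶_)
import Algebra.Properties.CommutativeMonoid.Sum
import Algebra.Properties.Monoid.Mult
open import Data.Nat as ℕ using (zero; suc; _∸_; _!)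
import Data.Nat.Properties as ℕ
open import Data.Nat.Properties using (_!*_!≢0)
open import Data.Nat.Divisibility using (_∣_; divides; ∣1⇒≡1; ∣⇒≤; m∣m*n)
open import Data.Nat.DivMod using (m*[n/m]≡n)
open import Data.Nat.Primality using (Prime; euclidsLemma; prime⇒nonTrivial)
open import Data.Nat.Combinatorics using (_C_; k![n∸k]!∣n!; nCk≡nC[n∸k]; nCn≡1)
open import Data.Nat.Combinatorics.Specification using (nCk≡n!/k![n-k]!)
open import Data.Integer as ℤ using (ℤ; -[1+_]) renaming (+_ to pos)
import Data.Integer.Properties as ℤ
import Data.Fin as Fin
import Data.Fin.Properties as Fin
open import Data.Fin.Permutation using (Permutation)
open import Data.List using ([]; _∷_; length; replicate; _++_)
open import Data.List.Properties using (length-++; length-replicate)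
open import Data.List.Relation.Unary.All using ([]; _∷_)
open import Data.Maybe using (Maybe; just; nothing)
open import Data.Empty using (⊥-elim)
open import Data.Sum using (_⊎_; inj₁; inj₂)
open import Data.Product using (Σ; ∃; _,_; proj₁; proj₂)
open import Function.Bundles using (Inverse; _↔_; mk↔ₛ′; mk⇔; Equivalence)
open import Relation.Nullary using (Dec; yes; no)
open import Relation.Nullary.Decidable using (¬?)
open import Relation.Binary.PropositionalEquality
  using (refl; sym; trans; cong; cong₂; subst; _≢_; module ≡-Reasoning)

injective⇒surjective-Fin : ∀ {k} (f : Fin k → Fin k) → (∀ i j → f i ≡ f j → i ≡ j) →
  ∀ y → ∃ λ x → f x ≡ y
injective⇒surjective-Fin f inj y with Fin.any? (λ x → f x Fin.≟ y)
... | yes hit = hit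
injective⇒surjective-Fin {suc k} f inj y | no miss =
  ⊥-elim (ℕ.<-irrefl refl (Fin.injective⇒≤ {f = squeeze} squeeze-injective))
  where
  -- f misses y, so it factors injectively through Fin k by deleting y
  avoids : ∀ i → y ≢ f i
  avoids i e = miss (i , sym e)
  squeeze : Fin (suc k) → Fin k
  squeeze i = Fin.punchOut (avoids i)
  squeeze-injective : ∀ {i j} → squeeze i ≡ squeeze j → i ≡ j
  squeeze-injective e = inj _ _ (Fin.punchOut-injective (avoids _) (avoids _) e)

prime≥2 : ∀ {p} → Prime p → 2 ℕ.≤ p
prime≥2 {p} p-prime = ℕ.nonTrivial⇒n>1 p {{prime⇒nonTrivial p-prime}}

prime∣!⇒≤ : ∀ {p} → Prime p → ∀ j → p ∣ j ! → p ℕ.≤ j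
prime∣!⇒≤ p-prime zero p∣1 = ⊥-elim (ℕ.<⇒≢ (prime≥2 p-prime) (sym (∣1⇒≡1 p∣1)))
prime∣!⇒≤ p-prime (suc j) p∣j! with euclidsLemma (suc j) (j !) p-prime p∣j!
... | inj₁ p∣1+j = ∣⇒≤ p∣1+j
... | inj₂ p∣j!′ = ℕ.m≤n⇒m≤1+n (prime∣!⇒≤ p-prime j p∣j!′)

choose-factorials : ∀ p k → k ℕ.≤ p → (k ! ℕ.* (p ∸ k) !) ℕ.* (p C k) ≡ p !
choose-factorials p k k≤p =
  trans (cong ((k ! ℕ.* (p ∸ k) !) ℕ.*_) (nCk≡n!/k![n-k]! k≤p))
        (m*[n/m]≡n {{k !* (p ∸ k) !≢0}} (k![n∸k]!∣n! k≤p))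

-- For a prime p and 0 < k < p, p divides the binomial coefficient p C k:
-- p divides p! = k!(p-k)! (p C k) but neither k! nor (p-k)!.
prime∣choose : ∀ p → Prime p → ∀ k → 0 < k → k < p → p ∣ p C k
prime∣choose p@(suc p-1) p-prime k 0<k k<p
  with euclidsLemma (k ! ℕ.* (p ∸ k) !) (p C k) p-prime
         (subst (p ∣_) (sym (choose-factorials p k (ℕ.<⇒≤ k<p))) (m∣m*n (p-1 !)))
... | inj₂ p∣choose = p∣choose
... | inj₁ p∣product with euclidsLemma (k !) ((p ∸ k) !) p-prime p∣product
...   | inj₁ p∣k! = ⊥-elim (ℕ.<⇒≱ k<p (prime∣!⇒≤ p-prime k p∣k!))
...   | inj₂ p∣[p-k]! =
        ⊥-elim (ℕ.<⇒≱ (ℕ.∸-monoʳ-< 0<k (ℕ.<⇒≤ k<p)) (prime∣!⇒≤ p-prime (p ∸ k) p∣[p-k]!))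

-- It lets the ring solver normalise with integer coefficients, which is
-- what makes identities involving cancellation (x - y + y = x) decidable by evaluation.
module IntegerCoefficientSolver {A : Set} {add mul : A → A → A} {neg : A → A} {0ᴬ 1ᴬ : A}
  (isCommutativeRing : IsCommutativeRing _≡_ add mul neg 0ᴬ 1ᴬ) where

  R : CommutativeRing 0ℓ 0ℓ
  R = record { isCommutativeRing = isCommutativeRing }

  open CommutativeRing R using (_+_; _*_; -_; 0#; 1#; +-assoc; +-comm; +-identityˡ; +-identityʳ; *-identityˡ;
    distribʳ; -‿inverseʳ; zeroˡ; +-abelianGroup; +-group; ring)
  open import Algebra.Properties.Ring ring using (-‿distribˡ-*; -‿distribʳ-*)
  open import Algebra.Properties.AbelianGroup +-abelianGroup using (⁻¹-∙-comm)
  open import Algebra.Properties.Group +-group using (⁻¹-involutive)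
  open ≡-Reasoning

  fromℕ : ℕ → A
  fromℕ zero = 0#
  fromℕ (suc k) = 1# + fromℕ k

  fromℕ-+ : ∀ a b → fromℕ (a ℕ.+ b) ≡ fromℕ a + fromℕ b
  fromℕ-+ zero b = sym (+-identityˡ _)
  fromℕ-+ (suc a) b = trans (cong (1# +_) (fromℕ-+ a b)) (sym (+-assoc _ _ _))

  fromℕ-* : ∀ a b → fromℕ (a ℕ.* b) ≡ fromℕ a * fromℕ b
  fromℕ-* zero b = sym (zeroˡ _)
  fromℕ-* (suc a) b = begin
    fromℕ (b ℕ.+ a ℕ.* b)          ≡⟨ fromℕ-+ b (a ℕ.* b) ⟩
    fromℕ b + fromℕ (a ℕ.* b)      ≡⟨ cong₂ _+_ (sym (*-identityˡ _)) (fromℕ-* a b) ⟩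
    1# * fromℕ b + fromℕ a * fromℕ b ≡⟨ sym (distribʳ _ _ _) ⟩
    (1# + fromℕ a) * fromℕ b       ∎

  fromℤ : ℤ → A
  fromℤ (pos k) = fromℕ k
  fromℤ -[1+ k ] = - fromℕ (suc k)

  -0≡0 : - 0# ≡ 0#
  -0≡0 = trans (sym (+-identityˡ _)) (-‿inverseʳ 0#)

  fromℤ-neg : ∀ i → fromℤ (ℤ.- i) ≡ - fromℤ i
  fromℤ-neg (pos zero) = sym -0≡0
  fromℤ-neg (pos (suc k)) = refl
  fromℤ-neg -[1+ k ] = sym (⁻¹-involutive _)

  fromℤ-⊖ : ∀ a b → fromℤ (a ℤ.⊖ b) ≡ fromℕ a + - fromℕ b
  fromℤ-⊖ zero zero = sym (-‿inverseʳ 0#)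
  fromℤ-⊖ zero (suc b) = sym (+-identityˡ _)
  fromℤ-⊖ (suc a) zero = sym (trans (cong (fromℕ (suc a) +_) -0≡0) (+-identityʳ _))
  fromℤ-⊖ (suc a) (suc b) = begin
    fromℤ (suc a ℤ.⊖ suc b)                  ≡⟨ cong fromℤ (ℤ.[1+m]⊖[1+n]≡m⊖n a b) ⟩
    fromℤ (a ℤ.⊖ b)                          ≡⟨ fromℤ-⊖ a b ⟩
    fromℕ a + - fromℕ b                      ≡⟨ cong (_+ - fromℕ b) (sym (+-identityˡ _)) ⟩
    0# + fromℕ a + - fromℕ b                 ≡⟨ cong (λ z → z + fromℕ a + - fromℕ b) (sym (-‿inverseʳ 1#)) ⟩
    1# + - 1# + fromℕ a + - fromℕ b          ≡⟨ cong (_+ - fromℕ b) (+-assoc _ _ _) ⟩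
    1# + (- 1# + fromℕ a) + - fromℕ b        ≡⟨ cong (λ z → 1# + z + - fromℕ b) (+-comm _ _) ⟩
    1# + (fromℕ a + - 1#) + - fromℕ b        ≡⟨ cong (_+ - fromℕ b) (sym (+-assoc _ _ _)) ⟩
    1# + fromℕ a + - 1# + - fromℕ b          ≡⟨ +-assoc _ _ _ ⟩
    1# + fromℕ a + (- 1# + - fromℕ b)        ≡⟨ cong ((1# + fromℕ a) +_) (⁻¹-∙-comm _ _) ⟩
    fromℕ (suc a) + - fromℕ (suc b)          ∎

  fromℤ-+ : ∀ i j → fromℤ (i ℤ.+ j) ≡ fromℤ i + fromℤ j
  fromℤ-+ -[1+ a ] -[1+ b ] = begin
    - (1# + (1# + fromℕ (a ℕ.+ b)))     ≡⟨ cong (λ z → - (1# + (1# + z))) (fromℕ-+ a b) ⟩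
    - (1# + (1# + (fromℕ a + fromℕ b))) ≡⟨ cong -_ (cong (1# +_) (sym (+-assoc _ _ _))) ⟩
    - (1# + (1# + fromℕ a + fromℕ b))   ≡⟨ cong -_ (cong (λ z → 1# + (z + fromℕ b)) (+-comm _ _)) ⟩
    - (1# + (fromℕ a + 1# + fromℕ b))   ≡⟨ cong -_ (cong (1# +_) (+-assoc _ _ _)) ⟩
    - (1# + (fromℕ a + (1# + fromℕ b))) ≡⟨ cong -_ (sym (+-assoc _ _ _)) ⟩
    - (1# + fromℕ a + (1# + fromℕ b))   ≡⟨ sym (⁻¹-∙-comm _ _) ⟩
    - fromℕ (suc a) + - fromℕ (suc b)   ∎
  fromℤ-+ -[1+ a ] (pos b) = trans (fromℤ-⊖ b (suc a)) (+-comm _ _)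
  fromℤ-+ (pos a) -[1+ b ] = fromℤ-⊖ a (suc b)
  fromℤ-+ (pos a) (pos b) = fromℕ-+ a b

  fromℤ-*⁺ : ∀ a j → fromℤ (pos a ℤ.* j) ≡ fromℕ a * fromℤ j
  fromℤ-*⁺ a (pos b) = trans (cong fromℤ (sym (ℤ.pos-* a b))) (fromℕ-* a b)
  fromℤ-*⁺ a -[1+ b ] = begin
    fromℤ (pos a ℤ.* ℤ.- pos (suc b))   ≡⟨ cong fromℤ (sym (ℤ.neg-distribʳ-* (pos a) (pos (suc b)))) ⟩
    fromℤ (ℤ.- (pos a ℤ.* pos (suc b))) ≡⟨ fromℤ-neg (pos a ℤ.* pos (suc b)) ⟩
    - fromℤ (pos a ℤ.* pos (suc b))     ≡⟨ cong -_ (trans (cong fromℤ (sym (ℤ.pos-* a (suc b)))) (fromℕ-* a (suc b))) ⟩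
    - (fromℕ a * fromℕ (suc b))   ≡⟨ -‿distribʳ-* _ _ ⟩
    fromℕ a * - fromℕ (suc b)     ∎

  fromℤ-* : ∀ i j → fromℤ (i ℤ.* j) ≡ fromℤ i * fromℤ j
  fromℤ-* (pos a) j = fromℤ-*⁺ a j
  fromℤ-* -[1+ a ] j = begin
    fromℤ (ℤ.- pos (suc a) ℤ.* j)     ≡⟨ cong fromℤ (sym (ℤ.neg-distribˡ-* (pos (suc a)) j)) ⟩
    fromℤ (ℤ.- (pos (suc a) ℤ.* j))   ≡⟨ fromℤ-neg (pos (suc a) ℤ.* j) ⟩
    - fromℤ (pos (suc a) ℤ.* j)       ≡⟨ cong -_ (fromℤ-*⁺ (suc a) j) ⟩
    - (fromℕ (suc a) * fromℤ j)     ≡⟨ -‿distribˡ-* _ _ ⟩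
    - fromℕ (suc a) * fromℤ j       ∎

  fromℤ-homomorphism : CommutativeRing.rawRing ℤ.+-*-commutativeRing
                         -Raw-AlmostCommutative⟶ fromCommutativeRing R
  fromℤ-homomorphism = record
    { ⟦_⟧ = fromℤ ; +-homo = fromℤ-+ ; *-homo = fromℤ-* ; -‿homo = fromℤ-neg
    ; 0-homo = refl ; 1-homo = +-identityʳ 1# }

  coefficient≟ : ∀ i j → Maybe (fromℤ i ≡ fromℤ j)
  coefficient≟ i j with i ℤ.≟ j
  ... | yes i≡j = just (cong fromℤ i≡j)
  ... | no _ = nothing

  open import Algebra.Solver.Ring (CommutativeRing.rawRing ℤ.+-*-commutativeRing)
    (fromCommutativeRing R) fromℤ-homomorphism coefficient≟ public

module FieldTheory {n : ℕ} (K : FiniteField n) (q : ℕ) where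
  open FiniteField K
  open ≡-Reasoning

  commutativeRing : CommutativeRing 0ℓ 0ℓ
  commutativeRing = record { isCommutativeRing = isCommutativeRing }

  open CommutativeRing commutativeRing
    using (+-assoc; +-comm; *-assoc; *-comm; +-identityˡ; +-identityʳ; *-identityˡ; *-identityʳ;
           distribˡ; distribʳ; -‿inverseʳ; zeroˡ; zeroʳ;
           +-commutativeMonoid; *-commutativeMonoid; semiring)

  open Inverse enumeration using (to; from)
    renaming (strictlyInverseˡ to to∘from; strictlyInverseʳ to from∘to)

  from-injective : ∀ i j → from i ≡ from j → i ≡ j
  from-injective i j e = trans (sym (to∘from i)) (trans (cong to e) (to∘from j))

  to-injective : ∀ x y → to x ≡ to y → x ≡ y
  to-injective x y e = trans (sym (from∘to x)) (trans (cong from e) (from∘to y))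

  infix 4 _≟_
  _≟_ : (x y : Carrier) → Dec (x ≡ y)
  x ≟ y with to x Fin.≟ to y
  ... | yes e = yes (to-injective x y e)
  ... | no ne = no (λ e → ne (cong to e))

  open IntegerCoefficientSolver isCommutativeRing using (solve; _:+_; _:*_; :-_; _:=_)

  open import Algebra.Properties.Semiring.Mult semiring public using () renaming (_×_ to _·_)
  open import Algebra.Properties.Semiring.Mult semiring using ()
    renaming (×-assocˡ to ·-assocˡ; ×-assoc-* to ·-assoc-*; ×-homo-1 to ·-homo-1; ×1-homo-* to ·1-homo-*)

  injective⇒surjective : (f : Carrier → Carrier) → (∀ x y → f x ≡ f y → x ≡ y) →
    ∀ y → ∃ λ x → f x ≡ y
  injective⇒surjective f inj y
    with injective⇒surjective-Fin (λ i → to (f (from i)))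
           (λ i j e → from-injective i j (inj _ _ (to-injective _ _ e))) (to y)
  ... | i , e = from i , to-injective _ _ e

  -- If g maps onto a decidable subset P from within P, it is injective on P: choosing
  -- preimages in P (and the identity off P) gives an injective, hence surjective,
  -- map s with g ∘ s = id on P, so s ∘ g = id on P.
  onto⇒injective-on : (P : Carrier → Set) → (∀ x → Dec (P x)) → (g : Carrier → Carrier) →
    (∀ y → P y → ∃ λ x → P x × g x ≡ y) → ∀ a b → P a → P b → g a ≡ g b → a ≡ b
  onto⇒injective-on P P? g g-onto a b a∈P b∈P ga≡gb =
    trans (sym (s∘g a a∈P)) (trans (cong s ga≡gb) (s∘g b b∈P))
    where
    section : ∀ y → Dec (P y) → Carrier
    section y (yes y∈P) = proj₁ (g-onto y y∈P)
    section y (no _) = y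
    s : Carrier → Carrier
    s y = section y (P? y)
    section-injective : ∀ x y dx dy → section x dx ≡ section y dy → x ≡ y
    section-injective x y (yes x∈P) (yes y∈P) e =
      trans (sym (proj₂ (proj₂ (g-onto x x∈P)))) (trans (cong g e) (proj₂ (proj₂ (g-onto y y∈P))))
    section-injective x y (yes x∈P) (no y∉P) e = ⊥-elim (y∉P (subst P e (proj₁ (proj₂ (g-onto x x∈P)))))
    section-injective x y (no x∉P) (yes y∈P) e = ⊥-elim (x∉P (subst P (sym e) (proj₁ (proj₂ (g-onto y y∈P)))))
    section-injective x y (no _) (no _) e = e
    g∘section : ∀ c z d → section z d ≡ c → P c → g c ≡ z
    g∘section c z (yes z∈P) e c∈P = trans (cong g (sym e)) (proj₂ (proj₂ (g-onto z z∈P)))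
    g∘section c z (no z∉P) e c∈P = ⊥-elim (z∉P (subst P (sym e) c∈P))
    s∘g : ∀ c → P c → s (g c) ≡ c
    s∘g c c∈P with injective⇒surjective s (λ x y → section-injective x y (P? x) (P? y)) c
    ... | z , sz≡c = trans (cong s (g∘section c z (P? z) sz≡c c∈P)) sz≡c

  +-cancelˡ : ∀ x y z → x + y ≡ x + z → y ≡ z
  +-cancelˡ x y z e = begin
    y             ≡⟨ solve 2 (λ x y → y := :- x :+ (x :+ y)) refl x y ⟩
    - x + (x + y) ≡⟨ cong (- x +_) e ⟩
    - x + (x + z) ≡⟨ solve 2 (λ x z → :- x :+ (x :+ z) := z) refl x z ⟩
    z             ∎

  difference≡0⇒≡ : ∀ x y → x + - y ≡ 0# → x ≡ y
  difference≡0⇒≡ x y e = begin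
    x           ≡⟨ solve 2 (λ x y → x := (x :+ :- y) :+ y) refl x y ⟩
    x + - y + y ≡⟨ cong (_+ y) e ⟩
    0# + y      ≡⟨ +-identityˡ y ⟩
    y           ∎

  *-cancelˡ : ∀ x y z → x ≢ 0# → x * y ≡ x * z → y ≡ z
  *-cancelˡ x y z x≢0 e with inverse x x≢0
  ... | x⁻¹ , xx⁻¹ = begin
    y               ≡⟨ sym (*-identityˡ y) ⟩
    1# * y          ≡⟨ cong (_* y) (sym xx⁻¹) ⟩
    x * x⁻¹ * y     ≡⟨ solve 3 (λ x i y → x :* i :* y := i :* (x :* y)) refl x x⁻¹ y ⟩
    x⁻¹ * (x * y)   ≡⟨ cong (x⁻¹ *_) e ⟩
    x⁻¹ * (x * z)   ≡⟨ solve 3 (λ x i z → i :* (x :* z) := x :* i :* z) refl x x⁻¹ z ⟩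
    x * x⁻¹ * z     ≡⟨ cong (_* z) xx⁻¹ ⟩
    1# * z          ≡⟨ *-identityˡ z ⟩
    z               ∎

  no-zero-divisors : ∀ x y → x * y ≡ 0# → x ≡ 0# ⊎ y ≡ 0#
  no-zero-divisors x y xy≡0 with x ≟ 0#
  ... | yes x≡0 = inj₁ x≡0
  ... | no x≢0 = inj₂ (*-cancelˡ x y 0# x≢0 (trans xy≡0 (sym (zeroʳ x))))

  *-nonzero : ∀ x y → x ≢ 0# → y ≢ 0# → x * y ≢ 0#
  *-nonzero x y x≢0 y≢0 xy≡0 with no-zero-divisors x y xy≡0
  ... | inj₁ x≡0 = x≢0 x≡0
  ... | inj₂ y≡0 = y≢0 y≡0

  Additive : (Carrier → Carrier) → Set
  Additive f = ∀ x y → f (x + y) ≡ f x + f y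

  additive-0 : ∀ f → Additive f → f 0# ≡ 0#
  additive-0 f f-add = sym (+-cancelˡ (f 0#) 0# (f 0#) (begin
    f 0# + 0#   ≡⟨ +-identityʳ _ ⟩
    f 0#        ≡⟨ cong f (sym (+-identityˡ 0#)) ⟩
    f (0# + 0#) ≡⟨ f-add 0# 0# ⟩
    f 0# + f 0# ∎))

  additive-neg : ∀ f → Additive f → ∀ x → f (- x) ≡ - f x
  additive-neg f f-add x = +-cancelˡ (f x) _ _ (begin
    f x + f (- x) ≡⟨ sym (f-add x (- x)) ⟩
    f (x + - x)   ≡⟨ cong f (-‿inverseʳ x) ⟩
    f 0#          ≡⟨ additive-0 f f-add ⟩
    0#            ≡⟨ sym (-‿inverseʳ (f x)) ⟩
    f x + - f x   ∎)

  additive-sub : ∀ f → Additive f → ∀ x y → f (x + - y) ≡ f x + - f y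
  additive-sub f f-add x y = trans (f-add x (- y)) (cong (f x +_) (additive-neg f f-add y))

  _^ᴷ_ : Carrier → ℕ → Carrier
  _^ᴷ_ = pow K q
  infixr 8 _^ᴷ_

  ^-+ : ∀ x a b → x ^ᴷ (a ℕ.+ b) ≡ x ^ᴷ a * x ^ᴷ b
  ^-+ x zero b = sym (*-identityˡ _)
  ^-+ x (suc a) b = trans (cong (x *_) (^-+ x a b)) (sym (*-assoc _ _ _))

  ^-distrib-* : ∀ x y a → (x * y) ^ᴷ a ≡ x ^ᴷ a * y ^ᴷ a
  ^-distrib-* x y zero = sym (*-identityˡ 1#)
  ^-distrib-* x y (suc a) = trans (cong ((x * y) *_) (^-distrib-* x y a))
    (solve 4 (λ x y u v → (x :* y) :* (u :* v) := (x :* u) :* (y :* v)) refl x y (x ^ᴷ a) (y ^ᴷ a))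

  1^ : ∀ a → 1# ^ᴷ a ≡ 1#
  1^ zero = refl
  1^ (suc a) = trans (*-identityˡ _) (1^ a)

  ^-* : ∀ x a b → x ^ᴷ (a ℕ.* b) ≡ (x ^ᴷ a) ^ᴷ b
  ^-* x zero b = sym (1^ b)
  ^-* x (suc a) b = begin
    x ^ᴷ (b ℕ.+ a ℕ.* b)        ≡⟨ ^-+ x b (a ℕ.* b) ⟩
    x ^ᴷ b * x ^ᴷ (a ℕ.* b)     ≡⟨ cong (x ^ᴷ b *_) (^-* x a b) ⟩
    x ^ᴷ b * (x ^ᴷ a) ^ᴷ b      ≡⟨ sym (^-distrib-* x (x ^ᴷ a) b) ⟩
    (x * x ^ᴷ a) ^ᴷ b           ∎

  ^-comm : ∀ x a b → (x ^ᴷ a) ^ᴷ b ≡ (x ^ᴷ b) ^ᴷ a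
  ^-comm x a b = trans (sym (^-* x a b)) (trans (cong (x ^ᴷ_) (ℕ.*-comm a b)) (^-* x b a))

  iterate-+ : ∀ r → Additive (_^ᴷ r) → ∀ j → Additive (_^ᴷ (r ^ j))
  iterate-+ r r-additive zero x y = trans (*-identityʳ _) (sym (cong₂ _+_ (*-identityʳ x) (*-identityʳ y)))
  iterate-+ r r-additive (suc j) x y = begin
    (x + y) ^ᴷ (r ℕ.* r ^ j)                  ≡⟨ ^-* (x + y) r (r ^ j) ⟩
    ((x + y) ^ᴷ r) ^ᴷ (r ^ j)                 ≡⟨ cong (_^ᴷ (r ^ j)) (r-additive x y) ⟩
    (x ^ᴷ r + y ^ᴷ r) ^ᴷ (r ^ j)              ≡⟨ iterate-+ r r-additive j (x ^ᴷ r) (y ^ᴷ r) ⟩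
    (x ^ᴷ r) ^ᴷ (r ^ j) + (y ^ᴷ r) ^ᴷ (r ^ j) ≡⟨ sym (cong₂ _+_ (^-* x r (r ^ j)) (^-* y r (r ^ j))) ⟩
    x ^ᴷ (r ℕ.* r ^ j) + y ^ᴷ (r ℕ.* r ^ j)   ∎

  ^-nonzero : ∀ x a → x ≢ 0# → x ^ᴷ a ≢ 0#
  ^-nonzero x zero x≢0 1≡0 = 0≢1 (sym 1≡0)
  ^-nonzero x (suc a) x≢0 = *-nonzero x (x ^ᴷ a) x≢0 (^-nonzero x a x≢0)

  ^≡0⇒≡0 : ∀ x a → x ^ᴷ a ≡ 0# → x ≡ 0#
  ^≡0⇒≡0 x a xᵃ≡0 with x ≟ 0#
  ... | yes x≡0 = x≡0
  ... | no x≢0 = ⊥-elim (^-nonzero x a x≢0 xᵃ≡0)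

  -- K contains 0, so its order is 1 + N; we index its elements by Fin (1 + N).
  N : ℕ
  N = ℕ.pred n

  n≡1+N : n ≡ suc N
  n≡1+N = inhabited (to 0#)
    where
    inhabited : ∀ {k} → Fin k → k ≡ suc (ℕ.pred k)
    inhabited {suc _} _ = refl

  enumeration′ : Carrier ↔ Fin (suc N)
  enumeration′ = subst (λ k → Carrier ↔ Fin k) n≡1+N enumeration

  open Inverse enumeration′ using () renaming
    (to to index; from to element; strictlyInverseˡ to index∘element; strictlyInverseʳ to element∘index)

  module Total (M : CommutativeMonoid 0ℓ 0ℓ) where
    open CommutativeMonoid M using (_≈_) renaming (trans to ≈-trans; reflexive to ≈-reflexive)
    open import Algebra.Properties.CommutativeMonoid.Sum M using (sum; sum-permute; sum-cong-≗)

    total : (Carrier → CommutativeMonoid.Carrier M) → CommutativeMonoid.Carrier M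
    total f = sum (λ i → f (element i))

    total-reindex : (σ σ⁻¹ : Carrier → Carrier) → (∀ x → σ (σ⁻¹ x) ≡ x) → (∀ x → σ⁻¹ (σ x) ≡ x) →
      ∀ f → total f ≈ total (λ x → f (σ x))
    total-reindex σ σ⁻¹ σσ⁻¹ σ⁻¹σ f =
      ≈-trans (sum-permute (λ i → f (element i)) π)
              (≈-reflexive (sum-cong-≗ {suc N} {λ i → f (element (index (σ (element i))))}
                (λ i → cong f (element∘index (σ (element i))))))
      where
      π : Permutation (suc N) (suc N)
      π = mk↔ₛ′ (λ i → index (σ (element i))) (λ i → index (σ⁻¹ (element i)))
        (λ i → trans (cong (λ z → index (σ z)) (element∘index _))
                      (trans (cong index (σσ⁻¹ _)) (index∘element i)))
        (λ i → trans (cong (λ z → index (σ⁻¹ z)) (element∘index _))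
                      (trans (cong index (σ⁻¹σ _)) (index∘element i)))

  private
    module Sums = Total +-commutativeMonoid
    module Products = Total *-commutativeMonoid
    module Sum⁺ = Algebra.Properties.CommutativeMonoid.Sum +-commutativeMonoid
    module Π = Algebra.Properties.CommutativeMonoid.Sum *-commutativeMonoid
    module Powers = Algebra.Properties.Monoid.Mult (CommutativeMonoid.monoid *-commutativeMonoid)

  product-nonzero : ∀ {k} (t : Fin k → Carrier) → (∀ i → t i ≢ 0#) → Π.sum t ≢ 0#
  product-nonzero {zero} t t≢0 1≡0 = 0≢1 (sym 1≡0)
  product-nonzero {suc k} t t≢0 =
    *-nonzero _ _ (t≢0 Fin.zero) (product-nonzero (λ i → t (Fin.suc i)) (λ i → t≢0 (Fin.suc i)))

  repeated-product≡^ : ∀ k x → k Powers.× x ≡ x ^ᴷ k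
  repeated-product≡^ zero x = refl
  repeated-product≡^ (suc k) x = cong (x *_) (repeated-product≡^ k x)

  -- Translation by a permutes K, so Σₓ (x + a) = Σₓ x, i.e. |K|·a = 0.
  |K|·a≡0 : ∀ a → suc N · a ≡ 0#
  |K|·a≡0 a = sym (+-cancelˡ S 0# _ (begin
    S + 0#                         ≡⟨ +-identityʳ S ⟩
    S                              ≡⟨ Sums.total-reindex (_+ a) (_+ - a)
                                        (λ x → solve 2 (λ x a → x :+ :- a :+ a := x) refl x a)
                                        (λ x → solve 2 (λ x a → x :+ a :+ :- a := x) refl x a) (λ x → x) ⟩
    Sums.total (λ x → x + a)       ≡⟨ Sum⁺.∑-distrib-+ element (λ _ → a) ⟩
    S + Sum⁺.sum {suc N} (λ _ → a)   ≡⟨ cong (S +_) (Sum⁺.sum-replicate (suc N)) ⟩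
    S + suc N · a                  ∎))
    where
    S : Carrier
    S = Sums.total (λ x → x)

  characteristic : n · 1# ≡ 0#
  characteristic = subst (λ k → k · 1# ≡ 0#) (sym n≡1+N) (|K|·a≡0 1#)

  -- x^|K| = x.  For a ≠ 0, multiplication by a permutes K; comparing the products of
  -- all elements (with 0 counted as 1) before and after the permutation gives a^N = 1.
  module _ (a : Carrier) (a≢0 : a ≢ 0#) where
    unit : (x : Carrier) → Dec (x ≡ 0#) → Carrier
    unit x (yes _) = 1#
    unit x (no _) = x

    -- the factor by which `unit` grows when x is multiplied by a
    scale : (x : Carrier) → Dec (x ≡ 0#) → Carrier
    scale x (yes _) = 1#
    scale x (no _) = a

    unit-nonzero : ∀ x d → unit x d ≢ 0#
    unit-nonzero x (yes _) 1≡0 = 0≢1 (sym 1≡0)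
    unit-nonzero x (no x≢0) = x≢0

    unit-scale : ∀ x (d : Dec (x ≡ 0#)) (d′ : Dec (a * x ≡ 0#)) → unit (a * x) d′ ≡ scale x d * unit x d
    unit-scale x (yes _) (yes _) = sym (*-identityˡ 1#)
    unit-scale x (yes x≡0) (no ax≢0) = ⊥-elim (ax≢0 (trans (cong (a *_) x≡0) (zeroʳ a)))
    unit-scale x (no x≢0) (yes ax≡0) = ⊥-elim (*-nonzero a x a≢0 x≢0 ax≡0)
    unit-scale x (no _) (no _) = refl

    scale-nonzero : ∀ x d → x ≢ 0# → scale x d ≡ a
    scale-nonzero x (yes x≡0) x≢0 = ⊥-elim (x≢0 x≡0)
    scale-nonzero x (no _) _ = refl

    product-of-scales : Products.total (λ x → scale x (x ≟ 0#)) ≡ a ^ᴷ N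
    product-of-scales = begin
      Π.sum (λ i → s (element i))                        ≡⟨ Π.sum-remove {N} {i = i₀} (λ i → s (element i)) ⟩
      s (element i₀) * Π.sum (λ j → s (element (Fin.punchIn i₀ j)))
        ≡⟨ cong₂ _*_ (trans (cong s (element∘index 0#)) s0≡1)
                     (Π.sum-cong-≗ {N} {λ j → s (element (Fin.punchIn i₀ j))} {λ _ → a} others) ⟩
      1# * Π.sum {N} (λ _ → a)                           ≡⟨ *-identityˡ _ ⟩
      Π.sum {N} (λ _ → a)                                ≡⟨ Π.sum-replicate N ⟩
      N Powers.× a                                       ≡⟨ repeated-product≡^ N a ⟩
      a ^ᴷ N                                             ∎
      where
      s : Carrier → Carrier
      s x = scale x (x ≟ 0#)
      i₀ : Fin (suc N)
      i₀ = index 0#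
      s0≡1 : s 0# ≡ 1#
      s0≡1 with 0# ≟ 0#
      ... | yes _ = refl
      ... | no 0≢0 = ⊥-elim (0≢0 refl)
      others : ∀ j → s (element (Fin.punchIn i₀ j)) ≡ a
      others j = scale-nonzero x (x ≟ 0#) (λ e → Fin.punchInᵢ≢i i₀ j (trans (sym (index∘element _)) (cong index e)))
        where
        x : Carrier
        x = element (Fin.punchIn i₀ j)

    a^N≡1 : a ^ᴷ N ≡ 1#
    a^N≡1 = sym (*-cancelˡ P 1# (a ^ᴷ N) P≢0 (begin
      P * 1#                                  ≡⟨ *-identityʳ P ⟩
      P
        ≡⟨ Products.total-reindex (a *_) (a⁻¹ *_) (cancel a a⁻¹ aa⁻¹) (cancel a⁻¹ a a⁻¹a) u ⟩
      Products.total (λ x → u (a * x))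
        ≡⟨ Π.sum-cong-≗ {suc N} {λ i → u (a * element i)}
             (λ i → unit-scale (element i) (element i ≟ 0#) (a * element i ≟ 0#)) ⟩
      Π.sum (λ i → s (element i) * u (element i))
        ≡⟨ Π.∑-distrib-+ (λ i → s (element i)) (λ i → u (element i)) ⟩
      Products.total s * P                    ≡⟨ cong (_* P) product-of-scales ⟩
      a ^ᴷ N * P                              ≡⟨ *-comm _ P ⟩
      P * a ^ᴷ N                              ∎))
      where
      u s : Carrier → Carrier
      u x = unit x (x ≟ 0#)
      s x = scale x (x ≟ 0#)
      P : Carrier
      P = Products.total u
      P≢0 : P ≢ 0#
      P≢0 = product-nonzero (λ i → u (element i)) (λ i → unit-nonzero (element i) (element i ≟ 0#))
      a⁻¹ : Carrier
      a⁻¹ = proj₁ (inverse a a≢0)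
      aa⁻¹ : a * a⁻¹ ≡ 1#
      aa⁻¹ = proj₂ (inverse a a≢0)
      a⁻¹a : a⁻¹ * a ≡ 1#
      a⁻¹a = trans (*-comm a⁻¹ a) aa⁻¹
      cancel : ∀ b c → b * c ≡ 1# → ∀ x → b * (c * x) ≡ x
      cancel b c bc≡1 x = trans (sym (*-assoc b c x)) (trans (cong (_* x) bc≡1) (*-identityˡ x))

  fermat : ∀ x → x ^ᴷ n ≡ x
  fermat x = subst (λ k → x ^ᴷ k ≡ x) (sym n≡1+N) (fermat′ (x ≟ 0#))
    where
    fermat′ : Dec (x ≡ 0#) → x ^ᴷ suc N ≡ x
    fermat′ (yes x≡0) = trans (cong (λ z → z ^ᴷ suc N) x≡0) (trans (zeroˡ _) (sym x≡0))
    fermat′ (no x≢0) = trans (cong (x *_) (a^N≡1 x x≢0)) (*-identityʳ x)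

  -- If |K| = p^e then p·1 = 0, since (p·1)^e = p^e·1 = 0 and K has no zero divisors.
  prime-power-characteristic : ∀ p e → n ≡ p ^ e → p · 1# ≡ 0#
  prime-power-characteristic p e n≡p^e =
    ^≡0⇒≡0 (p · 1#) e (trans (sym (·1-^ p e)) (subst (λ k → k · 1# ≡ 0#) n≡p^e characteristic))
    where
    ·1-^ : ∀ a e → (a ^ e) · 1# ≡ (a · 1#) ^ᴷ e
    ·1-^ a zero = +-identityʳ 1#
    ·1-^ a (suc e) = trans (·1-homo-* a (a ^ e)) (cong ((a · 1#) *_) (·1-^ a e))

  -- Frobenius: if p is prime and p·1 = 0 in K, then x ↦ x^p is additive, as the
  -- middle binomial coefficients of (x + y)^p vanish.
  module Frobenius (p : ℕ) (p-prime : Prime p) (p·1≡0 : p · 1# ≡ 0#) where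
    open import Algebra.Properties.Semiring.Exp semiring using () renaming (_^_ to _^ˢ_)

    ^ᴷ≡^ˢ : ∀ x e → x ^ᴷ e ≡ x ^ˢ e
    ^ᴷ≡^ˢ x zero = refl
    ^ᴷ≡^ˢ x (suc e) = cong (x *_) (^ᴷ≡^ˢ x e)

    p·x≡0 : ∀ x → p · x ≡ 0#
    p·x≡0 x = begin
      p · x          ≡⟨ cong (p ·_) (sym (*-identityˡ x)) ⟩
      p · (1# * x)   ≡⟨ sym (·-assoc-* p 1# x) ⟩
      (p · 1#) * x   ≡⟨ cong (_* x) p·1≡0 ⟩
      0# * x         ≡⟨ zeroˡ x ⟩
      0#             ∎

    middle-coefficient≡0 : ∀ k z → 0 < k → k < p → (p C k) · z ≡ 0#
    middle-coefficient≡0 k z 0<k k<p with prime∣choose p p-prime k 0<k k<p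
    ... | divides c pCk≡c*p = begin
      (p C k) · z     ≡⟨ cong (_· z) (trans pCk≡c*p (ℕ.*-comm c p)) ⟩
      (p ℕ.* c) · z   ≡⟨ sym (·-assocˡ z p c) ⟩
      p · (c · z)     ≡⟨ p·x≡0 (c · z) ⟩
      0#              ∎

    module _ (x y : Carrier) where
      open import Algebra.Properties.Semiring.Binomial semiring x y
        using (binomialTerm; binomialExpansion; theorem)
      open import Algebra.Properties.Semiring.Sum semiring using (sum; sum-init-last; sum-cong-≗; sum-replicate-zero)

      first-term : binomialTerm p Fin.zero ≡ y ^ˢ p
      first-term = begin
        (p C 0) · (1# * y ^ˢ p)   ≡⟨ cong (_· (1# * y ^ˢ p)) (trans (nCk≡nC[n∸k] {0} {p} ℕ.z≤n) (nCn≡1 p)) ⟩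
        1 · (1# * y ^ˢ p)         ≡⟨ ·-homo-1 _ ⟩
        1# * y ^ˢ p               ≡⟨ *-identityˡ _ ⟩
        y ^ˢ p                    ∎

      last-term : ∀ (k : Fin (suc p)) → Fin.toℕ k ≡ p → binomialTerm p k ≡ x ^ˢ p
      last-term k toℕk≡p rewrite toℕk≡p = begin
        (p C p) · (x ^ˢ p * y ^ˢ (p ∸ p))   ≡⟨ cong₂ (λ c e → c · (x ^ˢ p * y ^ˢ e)) (nCn≡1 p) (ℕ.n∸n≡0 p) ⟩
        1 · (x ^ˢ p * 1#)                   ≡⟨ ·-homo-1 _ ⟩
        x ^ˢ p * 1#                         ≡⟨ *-identityʳ _ ⟩
        x ^ˢ p                              ∎

      freshman : ∀ r → p ≡ suc (suc r) → binomialExpansion p ≡ x ^ˢ p + y ^ˢ p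
      freshman r refl = begin
        t Fin.zero + sum (λ k → t (Fin.suc k))
          ≡⟨ cong (t Fin.zero +_) (sum-init-last (λ k → t (Fin.suc k))) ⟩
        t Fin.zero + (sum (λ k → t (Fin.suc (Fin.inject₁ k))) + t (Fin.suc (Fin.fromℕ (suc r))))
          ≡⟨ cong₂ (λ a b → t Fin.zero + (a + b)) middle (last-term _ (cong suc (Fin.toℕ-fromℕ (suc r)))) ⟩
        t Fin.zero + (0# + x ^ˢ p)  ≡⟨ cong₂ _+_ first-term (+-identityˡ _) ⟩
        y ^ˢ p + x ^ˢ p              ≡⟨ +-comm _ _ ⟩
        x ^ˢ p + y ^ˢ p              ∎
        where
        t : Fin (suc p) → Carrier
        t = binomialTerm p
        middle : sum (λ k → t (Fin.suc (Fin.inject₁ k))) ≡ 0#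
        middle = trans (sum-cong-≗ {suc r} {λ k → t (Fin.suc (Fin.inject₁ k))} {λ _ → 0#}
            (λ k → middle-coefficient≡0 _ _ (ℕ.s≤s ℕ.z≤n)
               (ℕ.s≤s (subst (ℕ._< suc r) (sym (Fin.toℕ-inject₁ k)) (Fin.toℕ<n k)))))
          (sum-replicate-zero (suc r))

      frobenius-+ : (x + y) ^ᴷ p ≡ x ^ᴷ p + y ^ᴷ p
      frobenius-+ = begin
        (x + y) ^ᴷ p          ≡⟨ ^ᴷ≡^ˢ (x + y) p ⟩
        (x + y) ^ˢ p          ≡⟨ theorem (*-comm x y) p ⟩
        binomialExpansion p   ≡⟨ freshman (p ∸ 2) (sym (ℕ.m+[n∸m]≡n (prime≥2 p-prime))) ⟩
        x ^ˢ p + y ^ˢ p       ≡⟨ sym (cong₂ _+_ (^ᴷ≡^ˢ x p) (^ᴷ≡^ˢ y p)) ⟩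
        x ^ᴷ p + y ^ᴷ p       ∎

  ∑ : (m : ℕ) → (Fin m → Carrier) → Carrier
  ∑ = sumFin K q

  ∑-cong : ∀ m {G H : Fin m → Carrier} → (∀ i → G i ≡ H i) → ∑ m G ≡ ∑ m H
  ∑-cong zero G≗H = refl
  ∑-cong (suc m) G≗H = cong₂ _+_ (G≗H Fin.zero) (∑-cong m (λ i → G≗H (Fin.suc i)))

  ∑-+ : ∀ m (G H : Fin m → Carrier) → ∑ m (λ i → G i + H i) ≡ ∑ m G + ∑ m H
  ∑-+ zero G H = sym (+-identityˡ 0#)
  ∑-+ (suc m) G H = trans (cong (G Fin.zero + H Fin.zero +_) (∑-+ m (λ i → G (Fin.suc i)) (λ i → H (Fin.suc i))))
    (solve 4 (λ a b c d → (a :+ b) :+ (c :+ d) := (a :+ c) :+ (b :+ d)) refl (G Fin.zero) (H Fin.zero) _ _)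

  ∑-*ˡ : ∀ c m (G : Fin m → Carrier) → c * ∑ m G ≡ ∑ m (λ i → c * G i)
  ∑-*ˡ c zero G = zeroʳ c
  ∑-*ˡ c (suc m) G = trans (distribˡ c _ _) (cong (c * G Fin.zero +_) (∑-*ˡ c m (λ i → G (Fin.suc i))))

  additive-∑ : ∀ f → Additive f → ∀ m G → f (∑ m G) ≡ ∑ m (λ i → f (G i))
  additive-∑ f f-add zero G = additive-0 f f-add
  additive-∑ f f-add (suc m) G = trans (f-add _ _) (cong (f (G Fin.zero) +_) (additive-∑ f f-add m (λ i → G (Fin.suc i))))

  sumℕ : ℕ → (ℕ → Carrier) → Carrier
  sumℕ zero G = 0#
  sumℕ (suc k) G = G 0 + sumℕ k (λ j → G (suc j))

  ∑≡sumℕ : ∀ m (G : ℕ → Carrier) → ∑ m (λ i → G (Fin.toℕ i)) ≡ sumℕ m G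
  ∑≡sumℕ zero G = refl
  ∑≡sumℕ (suc m) G = cong (G 0 +_) (∑≡sumℕ m (λ j → G (suc j)))

  sumℕ-last : ∀ k (G : ℕ → Carrier) → sumℕ (suc k) G ≡ sumℕ k G + G k
  sumℕ-last zero G = trans (+-identityʳ _) (sym (+-identityˡ _))
  sumℕ-last (suc k) G = trans (cong (G 0 +_) (sumℕ-last k (λ j → G (suc j)))) (sym (+-assoc _ _ _))

  sumℕ-shift : ∀ k (G : ℕ → Carrier) → G k ≡ G 0 → sumℕ k (λ j → G (suc j)) ≡ sumℕ k G
  sumℕ-shift k G Gk≡G0 = +-cancelˡ (G 0) _ _ (begin
    G 0 + sumℕ k (λ j → G (suc j)) ≡⟨ sumℕ-last k G ⟩
    sumℕ k G + G k                 ≡⟨ cong (sumℕ k G +_) Gk≡G0 ⟩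
    sumℕ k G + G 0                 ≡⟨ +-comm _ _ ⟩
    G 0 + sumℕ k G                 ∎)

  module Subfield (frobenius-+ : Additive (_^ᴷ q)) where

    iterate-fixes-Fq : ∀ j c → InFq K q c → c ^ᴷ (q ^ j) ≡ c
    iterate-fixes-Fq zero c _ = *-identityʳ c
    iterate-fixes-Fq (suc j) c c∈Fq =
      trans (^-* c q (q ^ j)) (trans (cong (_^ᴷ (q ^ j)) c∈Fq) (iterate-fixes-Fq j c c∈Fq))

    Fq-0 : InFq K q 0#
    Fq-0 = additive-0 (_^ᴷ q) frobenius-+

    Fq-+ : ∀ x y → InFq K q x → InFq K q y → InFq K q (x + y)
    Fq-+ x y x∈Fq y∈Fq = trans (frobenius-+ x y) (cong₂ _+_ x∈Fq y∈Fq)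

    Fq-* : ∀ x y → InFq K q x → InFq K q y → InFq K q (x * y)
    Fq-* x y x∈Fq y∈Fq = trans (^-distrib-* x y q) (cong₂ _*_ x∈Fq y∈Fq)

    Fq-∑ : ∀ k (G : Fin k → Carrier) → (∀ i → InFq K q (G i)) → InFq K q (∑ k G)
    Fq-∑ zero G _ = Fq-0
    Fq-∑ (suc k) G G∈Fq = Fq-+ _ _ (G∈Fq Fin.zero) (Fq-∑ k (λ i → G (Fin.suc i)) (λ i → G∈Fq (Fin.suc i)))

    Fq-evalPoly : ∀ cs y → PolyOverFq K q cs → InFq K q y → InFq K q (evalPoly K q cs y)
    Fq-evalPoly [] y _ _ = Fq-0
    Fq-evalPoly (c ∷ cs) y (c∈Fq ∷ cs⊆Fq) y∈Fq = Fq-+ _ _ c∈Fq (Fq-* _ _ y∈Fq (Fq-evalPoly cs y cs⊆Fq y∈Fq))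

    Fq-inverse : ∀ t u → InFq K q t → t ≢ 0# → t * u ≡ 1# → InFq K q u
    Fq-inverse t u t∈Fq t≢0 tu≡1 = *-cancelˡ t (u ^ᴷ q) u t≢0 (begin
      t * u ^ᴷ q        ≡⟨ cong (_* u ^ᴷ q) (sym t∈Fq) ⟩
      t ^ᴷ q * u ^ᴷ q   ≡⟨ sym (^-distrib-* t u q) ⟩
      (t * u) ^ᴷ q      ≡⟨ cong (_^ᴷ q) tu≡1 ⟩
      1# ^ᴷ q           ≡⟨ 1^ q ⟩
      1#                ≡⟨ sym tu≡1 ⟩
      t * u             ∎)

    linearized-+ : ∀ m a → Additive (evalLin K q m a)
    linearized-+ m a x y = trans
      (∑-cong m (λ i → trans (cong (a i *_) (iterate-+ q frobenius-+ (Fin.toℕ i) x y)) (distribˡ (a i) _ _)))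
      (∑-+ m _ _)

    Fq-linearized : ∀ m a → LinOverFq K q m a → ∀ y → InFq K q y → InFq K q (evalLin K q m a y)
    Fq-linearized m a a⊆Fq y y∈Fq = Fq-∑ m _
      (λ i → Fq-* _ _ (a⊆Fq i) (subst (InFq K q) (sym (iterate-fixes-Fq (Fin.toℕ i) y y∈Fq)) y∈Fq))

    module Trace (m : ℕ) (x^qᵐ≡x : ∀ x → x ^ᴷ (q ^ m) ≡ x) where
      tr : Carrier → Carrier
      tr = Tr K q m

      tr-+ : Additive tr
      tr-+ x y = trans (∑-cong m (λ i → iterate-+ q frobenius-+ (Fin.toℕ i) x y)) (∑-+ m _ _)

      tr-scalar : ∀ c x → InFq K q c → tr (c * x) ≡ c * tr x
      tr-scalar c x c∈Fq = trans
        (∑-cong m (λ i → trans (^-distrib-* c x (q ^ Fin.toℕ i))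
                               (cong (_* x ^ᴷ (q ^ Fin.toℕ i)) (iterate-fixes-Fq (Fin.toℕ i) c c∈Fq))))
        (sym (∑-*ˡ c m _))

      -- Tr(x)^q = Σ_{i<m} x^(q^(i+1)) = Tr(x), as x^(q^m) = x^(q^0).
      tr-in-Fq : ∀ x → InFq K q (tr x)
      tr-in-Fq x = begin
        tr x ^ᴷ q                           ≡⟨ additive-∑ (_^ᴷ q) frobenius-+ m _ ⟩
        ∑ m (λ i → G (Fin.toℕ i) ^ᴷ q)      ≡⟨ ∑-cong m (λ i → G-step (Fin.toℕ i)) ⟩
        ∑ m (λ i → G (suc (Fin.toℕ i)))     ≡⟨ ∑≡sumℕ m (λ j → G (suc j)) ⟩
        sumℕ m (λ j → G (suc j))            ≡⟨ sumℕ-shift m G (trans (x^qᵐ≡x x) (sym (*-identityʳ x))) ⟩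
        sumℕ m G                            ≡⟨ sym (∑≡sumℕ m G) ⟩
        tr x                                ∎
        where
        G : ℕ → Carrier
        G j = x ^ᴷ (q ^ j)
        G-step : ∀ j → G j ^ᴷ q ≡ G (suc j)
        G-step j = trans (sym (^-* x (q ^ j) q)) (cong (x ^ᴷ_) (ℕ.*-comm (q ^ j) q))

      -- Tr is invariant under the Frobenius iterates, since they permute its terms.
      tr-iterate : ∀ j x → tr (x ^ᴷ (q ^ j)) ≡ tr x
      tr-iterate j x = begin
        tr (x ^ᴷ (q ^ j))                             ≡⟨ ∑-cong m (λ i → ^-comm x (q ^ j) (q ^ Fin.toℕ i)) ⟩
        ∑ m (λ i → (x ^ᴷ (q ^ Fin.toℕ i)) ^ᴷ (q ^ j)) ≡⟨ sym (additive-∑ (_^ᴷ (q ^ j)) (iterate-+ q frobenius-+ j) m _) ⟩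
        tr x ^ᴷ (q ^ j)                               ≡⟨ iterate-fixes-Fq j (tr x) (tr-in-Fq x) ⟩
        tr x                                          ∎

      tr-linearized : ∀ a → LinOverFq K q m a → ∀ x → tr (evalLin K q m a x) ≡ evalLin K q m a (tr x)
      tr-linearized a a⊆Fq x = begin
        tr (evalLin K q m a x)                     ≡⟨ additive-∑ tr tr-+ m _ ⟩
        ∑ m (λ i → tr (a i * x ^ᴷ (q ^ Fin.toℕ i))) ≡⟨ ∑-cong m (λ i → trans (tr-scalar (a i) _ (a⊆Fq i))
                                                                        (cong (a i *_) (tr-iterate (Fin.toℕ i) x))) ⟩
        ∑ m (λ i → a i * tr x)                     ≡⟨ ∑-cong m (λ i → cong (a i *_)
                                                         (sym (iterate-fixes-Fq (Fin.toℕ i) (tr x) (tr-in-Fq x)))) ⟩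
        evalLin K q m a (tr x)                     ∎

      -- If Tr is not identically zero then it maps K onto F_q: y = Tr((y / Tr w) · w).
      tr-onto : ∀ w → tr w ≢ 0# → ∀ y → InFq K q y → ∃ λ x → tr x ≡ y
      tr-onto w tr-w≢0 y y∈Fq = y * u * w , (begin
        tr (y * u * w)   ≡⟨ tr-scalar (y * u) w (Fq-* y u y∈Fq u∈Fq) ⟩
        y * u * tr w     ≡⟨ solve 3 (λ y u t → y :* u :* t := y :* (t :* u)) refl y u (tr w) ⟩
        y * (tr w * u)   ≡⟨ cong (y *_) tr-w·u≡1 ⟩
        y * 1#           ≡⟨ *-identityʳ y ⟩
        y                ∎)
        where
        u : Carrier
        u = proj₁ (inverse (tr w) tr-w≢0)
        tr-w·u≡1 : tr w * u ≡ 1#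
        tr-w·u≡1 = proj₂ (inverse (tr w) tr-w≢0)
        u∈Fq : InFq K q u
        u∈Fq = Fq-inverse (tr w) u (tr-in-Fq w) tr-w≢0 tr-w·u≡1

  monic : List Carrier → Carrier → Carrier
  monic [] x = 1#
  monic (c ∷ cs) x = c + x * monic cs x

  monic≡ : ∀ cs x → monic cs x ≡ evalPoly K q cs x + x ^ᴷ length cs
  monic≡ [] x = sym (+-identityˡ 1#)
  monic≡ (c ∷ cs) x = trans (cong (λ z → c + x * z) (monic≡ cs x))
    (solve 4 (λ c x a b → c :+ x :* (a :+ b) := c :+ x :* a :+ x :* b) refl c x _ _)

  quotient : Carrier → List Carrier → List Carrier
  quotient r [] = []
  quotient r (c ∷ []) = []
  quotient r (c ∷ d ∷ ds) = monic (d ∷ ds) r ∷ quotient r (d ∷ ds)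

  length-quotient : ∀ r c cs → length (quotient r (c ∷ cs)) ≡ length cs
  length-quotient r c [] = refl
  length-quotient r c (d ∷ ds) = cong suc (length-quotient r d ds)

  division : ∀ r c cs x → monic (c ∷ cs) x + - monic (c ∷ cs) r ≡ (x + - r) * monic (quotient r (c ∷ cs)) x
  division r c [] x = solve 4 (λ r c x o → c :+ x :* o :+ :- (c :+ r :* o) := (x :+ :- r) :* o) refl r c x 1#
  division r c (d ∷ ds) x = begin
    c + x * f[x] + - (c + r * f[r])                  ≡⟨ cong (λ z → c + x * z + - (c + r * f[r])) f[x]≡ ⟩
    c + x * (f[r] + (x + - r) * g[x]) + - (c + r * f[r])
      ≡⟨ solve 5 (λ c x r f g → c :+ x :* (f :+ (x :+ :- r) :* g) :+ :- (c :+ r :* f) := (x :+ :- r) :* (f :+ x :* g))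
               refl c x r f[r] g[x] ⟩
    (x + - r) * (f[r] + x * g[x])                    ∎
    where
    f[x] f[r] g[x] : Carrier
    f[x] = monic (d ∷ ds) x
    f[r] = monic (d ∷ ds) r
    g[x] = monic (quotient r (d ∷ ds)) x
    f[x]≡ : f[x] ≡ f[r] + (x + - r) * g[x]
    f[x]≡ = trans (solve 2 (λ a b → a := b :+ (a :+ :- b)) refl f[x] f[r]) (cong (f[r] +_) (division r d ds x))

  root-bound : ∀ cs k (r : Fin k → Carrier) → (∀ i j → r i ≡ r j → i ≡ j) →
    (∀ i → monic cs (r i) ≡ 0#) → k ℕ.≤ length cs
  root-bound cs zero r r-injective roots = ℕ.z≤n
  root-bound [] (suc k) r r-injective roots = ⊥-elim (0≢1 (sym (roots Fin.zero)))
  root-bound (c ∷ cs) (suc k) r r-injective roots = ℕ.s≤s (subst (k ℕ.≤_) (length-quotient r₀ c cs)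
      (root-bound (quotient r₀ (c ∷ cs)) k (λ i → r (Fin.suc i))
        (λ i j e → Fin.suc-injective (r-injective (Fin.suc i) (Fin.suc j) e)) quotient-roots))
    where
    r₀ : Carrier
    r₀ = r Fin.zero
    -- the remaining roots are roots of the quotient, as x - r₀ ≠ 0 there
    quotient-roots : ∀ i → monic (quotient r₀ (c ∷ cs)) (r (Fin.suc i)) ≡ 0#
    quotient-roots i with no-zero-divisors (r (Fin.suc i) + - r₀) (monic (quotient r₀ (c ∷ cs)) (r (Fin.suc i)))
       (trans (sym (division r₀ c cs (r (Fin.suc i))))
              (trans (cong₂ (λ a b → a + - b) (roots (Fin.suc i)) (roots Fin.zero)) (-‿inverseʳ 0#)))
    ... | inj₂ g≡0 = g≡0
    ... | inj₁ d≡0 with r-injective (Fin.suc i) Fin.zero (difference≡0⇒≡ _ _ d≡0)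
    ...   | ()

  DegreeBelow : ℕ → (Carrier → Carrier) → Set
  DegreeBelow D g = Σ (List Carrier) λ cs → length cs ≡ D × (∀ x → g x ≡ evalPoly K q cs x)

  evalPoly-zeros : ∀ d x → evalPoly K q (replicate d 0#) x ≡ 0#
  evalPoly-zeros zero x = refl
  evalPoly-zeros (suc d) x = trans (cong (λ z → 0# + x * z) (evalPoly-zeros d x)) (trans (+-identityˡ _) (zeroʳ x))

  evalPoly-shift : ∀ k cs x → evalPoly K q (replicate k 0# ++ cs) x ≡ x ^ᴷ k * evalPoly K q cs x
  evalPoly-shift zero cs x = sym (*-identityˡ _)
  evalPoly-shift (suc k) cs x = trans (+-identityˡ _)
    (trans (cong (x *_) (evalPoly-shift k cs x)) (sym (*-assoc _ _ _)))

  degreeBelow-monomial : ∀ D k → k < D → DegreeBelow D (_^ᴷ k)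
  degreeBelow-monomial D k k<D = replicate k 0# ++ 1# ∷ replicate (D ∸ suc k) 0# , length≡D , evaluation
    where
    length≡D : length (replicate k 0# ++ 1# ∷ replicate (D ∸ suc k) 0#) ≡ D
    length≡D = begin
      length (replicate k 0# ++ 1# ∷ replicate (D ∸ suc k) 0#) ≡⟨ length-++ (replicate k 0#) ⟩
      length (replicate k 0#) ℕ.+ suc (length (replicate (D ∸ suc k) 0#))
        ≡⟨ cong₂ (λ a b → a ℕ.+ suc b) (length-replicate k) (length-replicate (D ∸ suc k)) ⟩
      k ℕ.+ suc (D ∸ suc k) ≡⟨ ℕ.+-suc k (D ∸ suc k) ⟩
      suc k ℕ.+ (D ∸ suc k) ≡⟨ ℕ.m+[n∸m]≡n k<D ⟩
      D                     ∎
    evaluation : ∀ x → x ^ᴷ k ≡ evalPoly K q (replicate k 0# ++ 1# ∷ replicate (D ∸ suc k) 0#) x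
    evaluation x = sym (begin
      evalPoly K q (replicate k 0# ++ 1# ∷ replicate (D ∸ suc k) 0#) x ≡⟨ evalPoly-shift k _ x ⟩
      x ^ᴷ k * (1# + x * evalPoly K q (replicate (D ∸ suc k) 0#) x)
        ≡⟨ cong (λ z → x ^ᴷ k * (1# + x * z)) (evalPoly-zeros (D ∸ suc k) x) ⟩
      x ^ᴷ k * (1# + x * 0#) ≡⟨ cong (λ z → x ^ᴷ k * (1# + z)) (zeroʳ x) ⟩
      x ^ᴷ k * (1# + 0#)     ≡⟨ cong (x ^ᴷ k *_) (+-identityʳ 1#) ⟩
      x ^ᴷ k * 1#            ≡⟨ *-identityʳ _ ⟩
      x ^ᴷ k                 ∎)

  _⊕_ : List Carrier → List Carrier → List Carrier
  [] ⊕ bs = bs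
  (a ∷ as) ⊕ [] = a ∷ as
  (a ∷ as) ⊕ (b ∷ bs) = (a + b) ∷ (as ⊕ bs)

  evalPoly-⊕ : ∀ as bs x → evalPoly K q (as ⊕ bs) x ≡ evalPoly K q as x + evalPoly K q bs x
  evalPoly-⊕ [] bs x = sym (+-identityˡ _)
  evalPoly-⊕ (a ∷ as) [] x = sym (+-identityʳ _)
  evalPoly-⊕ (a ∷ as) (b ∷ bs) x = trans (cong (λ z → (a + b) + x * z) (evalPoly-⊕ as bs x))
    (solve 5 (λ a b x u v → (a :+ b) :+ x :* (u :+ v) := (a :+ x :* u) :+ (b :+ x :* v)) refl a b x _ _)

  length-⊕ : ∀ as bs → length as ≡ length bs → length (as ⊕ bs) ≡ length as
  length-⊕ [] [] _ = refl
  length-⊕ (a ∷ as) (b ∷ bs) e = cong suc (length-⊕ as bs (ℕ.suc-injective e))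

  degreeBelow-sumℕ : ∀ D k (G : ℕ → Carrier → Carrier) → (∀ j → j < k → DegreeBelow D (G j)) →
    DegreeBelow D (λ x → sumℕ k (λ j → G j x))
  degreeBelow-sumℕ D zero G _ = replicate D 0# , length-replicate D , λ x → sym (evalPoly-zeros D x)
  degreeBelow-sumℕ D (suc k) G G<D
    with G<D 0 (ℕ.s≤s ℕ.z≤n) | degreeBelow-sumℕ D k (λ j → G (suc j)) (λ j j<k → G<D (suc j) (ℕ.s≤s j<k))
  ... | as , |as|≡D , G₀≡as | bs , |bs|≡D , rest≡bs =
    as ⊕ bs , trans (length-⊕ as bs (trans |as|≡D (sym |bs|≡D))) |as|≡D ,
    λ x → trans (cong₂ _+_ (G₀≡as x) (rest≡bs x)) (sym (evalPoly-⊕ as bs x))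

  -- For q > 1 and |K| = q^(m'+1), the trace x^(q^m') + Σ_{j<m'} x^(q^j) is a monic
  -- polynomial of degree q^m' < |K|, so it cannot vanish on all of K.
  tr-nonvanishing : ∀ m′ → 1 < q → n ≡ q ^ suc m′ → ∃ λ w → Tr K q (suc m′) w ≢ 0#
  tr-nonvanishing m′ 1<q n≡q^m
    with Fin.any? (λ i → ¬? (Tr K q (suc m′) (from i) ≟ 0#))
  ... | yes (i , tr≢0) = from i , tr≢0
  ... | no all-roots = ⊥-elim (ℕ.<⇒≱ (ℕ.^-monoʳ-< q 1<q (ℕ.n<1+n m′))
        (subst (ℕ._≤ q ^ m′) n≡q^m (subst (n ℕ.≤_) |cs|≡D
          (root-bound cs n from from-injective (λ i → trans (sym (tr≡monic (from i))) (vanishes (from i)))))))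
    where
    D : ℕ
    D = q ^ m′
    lower : DegreeBelow D (λ x → sumℕ m′ (λ j → x ^ᴷ (q ^ j)))
    lower = degreeBelow-sumℕ D m′ (λ j x → x ^ᴷ (q ^ j)) (λ j j<m′ → degreeBelow-monomial D (q ^ j) (ℕ.^-monoʳ-< q 1<q j<m′))
    cs : List Carrier
    cs = proj₁ lower
    |cs|≡D : length cs ≡ D
    |cs|≡D = proj₁ (proj₂ lower)
    tr≡monic : ∀ x → Tr K q (suc m′) x ≡ monic cs x
    tr≡monic x = begin
      Tr K q (suc m′) x                                ≡⟨ ∑≡sumℕ (suc m′) (λ j → x ^ᴷ (q ^ j)) ⟩
      sumℕ (suc m′) (λ j → x ^ᴷ (q ^ j))               ≡⟨ sumℕ-last m′ (λ j → x ^ᴷ (q ^ j)) ⟩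
      sumℕ m′ (λ j → x ^ᴷ (q ^ j)) + x ^ᴷ D            ≡⟨ cong₂ _+_ (proj₂ (proj₂ lower) x) (cong (x ^ᴷ_) (sym |cs|≡D)) ⟩
      evalPoly K q cs x + x ^ᴷ length cs               ≡⟨ sym (monic≡ cs x) ⟩
      monic cs x                                       ∎
    vanishes : ∀ x → Tr K q (suc m′) x ≡ 0#
    vanishes x with Tr K q (suc m′) x ≟ 0#
    ... | yes tr≡0 = tr≡0
    ... | no tr≢0 = ⊥-elim (all-roots (to x , subst (λ z → Tr K q (suc m′) z ≢ 0#) (sym (from∘to x)) tr≢0))

  module Criterion (frobenius-+ : Additive (_^ᴷ q)) (m : ℕ) (x^qᵐ≡x : ∀ x → x ^ᴷ (q ^ m) ≡ x)
    (w : Carrier) (tr-w≢0 : Tr K q m w ≢ 0#)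
    (L₁ L₂ : Fin m → Carrier) (L₁⊆Fq : LinOverFq K q m L₁) (L₂⊆Fq : LinOverFq K q m L₂)
    (h : List Carrier) (h⊆Fq : PolyOverFq K q h) (γ : Carrier) where

    open Subfield frobenius-+
    open Trace m x^qᵐ≡x

    ℓ₁ ℓ₂ H : Carrier → Carrier
    ℓ₁ = evalLin K q m L₁
    ℓ₂ = evalLin K q m L₂
    H = evalPoly K q h

    F g : Carrier → Carrier
    F x = ℓ₁ x + (ℓ₂ x + γ) * H (tr x)
    g y = ℓ₁ y + (ℓ₂ y + tr γ) * H y

    KernelCondition : Set
    KernelCondition = ∀ y → InFq K q y → ∀ x → ((ℓ₁ x + ℓ₂ x * H y ≡ 0#) × (tr x ≡ 0#)) ⇔ (x ≡ 0#)

    tr∘F≡g∘tr : ∀ x → tr (F x) ≡ g (tr x)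
    tr∘F≡g∘tr x = begin
      tr (ℓ₁ x + (ℓ₂ x + γ) * c)           ≡⟨ tr-+ _ _ ⟩
      tr (ℓ₁ x) + tr ((ℓ₂ x + γ) * c)      ≡⟨ cong₂ _+_ (tr-linearized L₁ L₁⊆Fq x) (cong tr (*-comm _ c)) ⟩
      ℓ₁ (tr x) + tr (c * (ℓ₂ x + γ))      ≡⟨ cong (ℓ₁ (tr x) +_) (tr-scalar c _ (Fq-evalPoly h (tr x) h⊆Fq (tr-in-Fq x))) ⟩
      ℓ₁ (tr x) + c * tr (ℓ₂ x + γ)        ≡⟨ cong (λ z → ℓ₁ (tr x) + c * z) (trans (tr-+ _ _) (cong (_+ tr γ) (tr-linearized L₂ L₂⊆Fq x))) ⟩
      ℓ₁ (tr x) + c * (ℓ₂ (tr x) + tr γ)   ≡⟨ cong (ℓ₁ (tr x) +_) (*-comm c _) ⟩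
      g (tr x)                             ∎
      where
      c : Carrier
      c = H (tr x)

    F-difference : ∀ x x′ → tr x ≡ tr x′ → F x + - F x′ ≡ ℓ₁ (x + - x′) + ℓ₂ (x + - x′) * H (tr x)
    F-difference x x′ same-trace = begin
      F x + - F x′
        ≡⟨ cong (λ z → F x + - (ℓ₁ x′ + (ℓ₂ x′ + γ) * H z)) (sym same-trace) ⟩
      ℓ₁ x + (ℓ₂ x + γ) * c + - (ℓ₁ x′ + (ℓ₂ x′ + γ) * c)
        ≡⟨ solve 6 (λ a a′ b b′ γ c → a :+ (b :+ γ) :* c :+ :- (a′ :+ (b′ :+ γ) :* c) := a :+ :- a′ :+ (b :+ :- b′) :* c)
             refl (ℓ₁ x) (ℓ₁ x′) (ℓ₂ x) (ℓ₂ x′) γ c ⟩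
      ℓ₁ x + - ℓ₁ x′ + (ℓ₂ x + - ℓ₂ x′) * c
        ≡⟨ sym (cong₂ (λ u v → u + v * c) (additive-sub ℓ₁ (linearized-+ m L₁) x x′) (additive-sub ℓ₂ (linearized-+ m L₂) x x′)) ⟩
      ℓ₁ (x + - x′) + ℓ₂ (x + - x′) * c    ∎
      where
      c : Carrier
      c = H (tr x)

    zero-satisfies-kernel-equations : ∀ y x → x ≡ 0# → (ℓ₁ x + ℓ₂ x * H y ≡ 0#) × (tr x ≡ 0#)
    zero-satisfies-kernel-equations y x refl =
      trans (cong₂ (λ u v → u + v * H y) (additive-0 ℓ₁ (linearized-+ m L₁)) (additive-0 ℓ₂ (linearized-+ m L₂)))
            (trans (cong (0# +_) (zeroˡ _)) (+-identityʳ 0#)) ,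
      additive-0 tr tr-+

    -- (⇐) If F x = F x′ then g(Tr x) = g(Tr x′), so Tr x = Tr x′; then x - x′ lies in
    -- the kernel of Tr and solves L₁ + h(Tr x)·L₂ = 0, so x = x′.  Injective ⇒ bijective.
    permutation-if : IsPermOfFq K q g × KernelCondition → IsPermOfK K q F
    permutation-if ((_ , g-injective , _) , kernel) = F-injective , F-surjective
      where
      F-injective : ∀ {x x′} → F x ≡ F x′ → x ≡ x′
      F-injective {x} {x′} Fx≡Fx′ = difference≡0⇒≡ x x′ (Equivalence.to (kernel (tr x) (tr-in-Fq x) (x + - x′))
        ( trans (sym (F-difference x x′ same-trace)) (trans (cong (_+ - F x′) Fx≡Fx′) (-‿inverseʳ (F x′)))
        , trans (additive-sub tr tr-+ x x′) (trans (cong (tr x +_) (cong -_ (sym same-trace))) (-‿inverseʳ (tr x)))))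
        where
        same-trace : tr x ≡ tr x′
        same-trace = g-injective (tr x) (tr x′) (tr-in-Fq x) (tr-in-Fq x′)
          (trans (sym (tr∘F≡g∘tr x)) (trans (cong tr Fx≡Fx′) (tr∘F≡g∘tr x′)))
      F-surjective : ∀ y → ∃ λ x → ∀ {z} → z ≡ x → F z ≡ y
      F-surjective y = proj₁ preimage , λ z≡x → trans (cong F z≡x) (proj₂ preimage)
        where
        preimage : ∃ λ x → F x ≡ y
        preimage = injective⇒surjective F (λ _ _ → F-injective) y

    module _ (F-perm : IsPermOfK K q F) where
      F-injective : ∀ {x x′} → F x ≡ F x′ → x ≡ x′
      F-injective = proj₁ F-perm

      F-onto : ∀ z → ∃ λ x → F x ≡ z
      F-onto z = proj₁ (proj₂ F-perm z) , proj₂ (proj₂ F-perm z) refl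

      g-maps-Fq : ∀ y → InFq K q y → InFq K q (g y)
      g-maps-Fq y y∈Fq = Fq-+ _ _ (Fq-linearized m L₁ L₁⊆Fq y y∈Fq)
        (Fq-* _ _ (Fq-+ _ _ (Fq-linearized m L₂ L₂⊆Fq y y∈Fq) (tr-in-Fq γ)) (Fq-evalPoly h y h⊆Fq y∈Fq))

      -- y = Tr z for some z, and z = F x; then g(Tr x) = Tr(F x) = y.
      g-onto-Fq : ∀ y → InFq K q y → ∃ λ x → InFq K q x × g x ≡ y
      g-onto-Fq y y∈Fq with tr-onto w tr-w≢0 y y∈Fq
      ... | z , tr-z≡y with F-onto z
      ...   | x , Fx≡z = tr x , tr-in-Fq x , trans (sym (tr∘F≡g∘tr x)) (trans (cong tr Fx≡z) tr-z≡y)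

      -- With Tr z = y: if x solves both kernel equations, F(z + x) = F(z), so x = 0.
      kernel-condition : KernelCondition
      kernel-condition y y∈Fq x = mk⇔ only-zero (zero-satisfies-kernel-equations y x)
        where
        only-zero : (ℓ₁ x + ℓ₂ x * H y ≡ 0#) × (tr x ≡ 0#) → x ≡ 0#
        only-zero (equation , tr-x≡0) = +-cancelˡ z x 0# (trans (F-injective F[z+x]≡F[z]) (sym (+-identityʳ z)))
          where
          z : Carrier
          z = proj₁ (tr-onto w tr-w≢0 y y∈Fq)
          tr-z≡y : tr z ≡ y
          tr-z≡y = proj₂ (tr-onto w tr-w≢0 y y∈Fq)
          same-trace : tr (z + x) ≡ tr z
          same-trace = trans (tr-+ z x) (trans (cong (tr z +_) tr-x≡0) (+-identityʳ _))
          F[z+x]≡F[z] : F (z + x) ≡ F z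
          F[z+x]≡F[z] = difference≡0⇒≡ _ _ (begin
            F (z + x) + - F z                                          ≡⟨ F-difference (z + x) z same-trace ⟩
            ℓ₁ (z + x + - z) + ℓ₂ (z + x + - z) * H (tr (z + x))
              ≡⟨ cong₂ (λ u v → ℓ₁ u + ℓ₂ u * H v) (solve 2 (λ z x → z :+ x :+ :- z := x) refl z x) (trans same-trace tr-z≡y) ⟩
            ℓ₁ x + ℓ₂ x * H y                                          ≡⟨ equation ⟩
            0#                                                         ∎)

      permutation-only-if : IsPermOfFq K q g × KernelCondition
      permutation-only-if =
        (g-maps-Fq , onto⇒injective-on (InFq K q) (λ y → y ^ᴷ q ≟ y) g g-onto-Fq , g-onto-Fq) , kernel-condition

    criterion : IsPermOfK K q F ⇔ (IsPermOfFq K q g × KernelCondition)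
    criterion = mk⇔ permutation-only-if permutation-if

corollary2p1 : (q m : ℕ) → IsPrimePower q → 1 < m →
    (K : FiniteField (q ^ m)) →
    (L₁ L₂ : Fin m → FiniteField.Carrier K) →
    LinOverFq K q m L₁ → LinOverFq K q m L₂ →
    (h : List (FiniteField.Carrier K)) → PolyOverFq K q h →
    (γ : FiniteField.Carrier K) →
    IsPermOfK K q (λ x → FiniteField._+_ K (evalLin K q m L₁ x)
        (FiniteField._*_ K (FiniteField._+_ K (evalLin K q m L₂ x) γ)
          (evalPoly K q h (Tr K q m x))))
    ⇔
    (IsPermOfFq K q (λ y → FiniteField._+_ K (evalLin K q m L₁ y)
        (FiniteField._*_ K (FiniteField._+_ K (evalLin K q m L₂ y) (Tr K q m γ))
          (evalPoly K q h y)))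
     ×
     (∀ y → InFq K q y → ∀ x →
        ((FiniteField._+_ K (evalLin K q m L₁ x)
            (FiniteField._*_ K (evalLin K q m L₂ x) (evalPoly K q h y))
            ≡ FiniteField.0# K)
         × (Tr K q m x ≡ FiniteField.0# K))
        ⇔ (x ≡ FiniteField.0# K)))
corollary2p1 q m@(suc m′) (p , k , p-prime , 1≤k , q≡p^k) _ K L₁ L₂ L₁⊆Fq L₂⊆Fq h h⊆Fq γ =
  Criterion.criterion frobenius-q m fermat (proj₁ nonvanishing) (proj₂ nonvanishing)
    L₁ L₂ L₁⊆Fq L₂⊆Fq h h⊆Fq γ
  where
  open FieldTheory K q
  -- K has characteristic p, as |K| = p^(k·m) ...
  p·1≡0 : p · FiniteField.1# K ≡ FiniteField.0# K
  p·1≡0 = prime-power-characteristic p (k ℕ.* m) (trans (cong (_^ m) q≡p^k) (ℕ.^-*-assoc p k m))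
  -- ... so x ↦ x^q = x^(p^k) is additive,
  frobenius-q : Additive (_^ᴷ q)
  frobenius-q = subst (λ r → Additive (_^ᴷ r)) (sym q≡p^k) (iterate-+ p (Frobenius.frobenius-+ p p-prime p·1≡0) k)
  -- and, as 1 < q, the trace (of degree q^(m-1) < |K|) does not vanish identically.
  -- Fermat's x^(q^m) = x holds because |K| = q^m.
  1<q : 1 < q
  1<q = subst (_< q) (ℕ.^-zeroˡ k) (subst (1 ^ k <_) (sym q≡p^k)
          (ℕ.^-monoˡ-< k {{ℕ.>-nonZero 1≤k}} (prime≥2 p-prime)))
  nonvanishing : ∃ λ w → Tr K q m w ≢ FiniteField.0# K
  nonvanishing = tr-nonvanishing m′ 1<q refl
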